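{- Consider an instance with unique lower and upper limit trees satisfying $T_L=T_U$. Let $i\in\{1,\dots,l\}$ and let $l_i\in C_i\setminus\{f_i\}$ with $I_{l_i}\cap I_{f_i}\ne\emptyset$ be such that $l_i\notin C_j$ for all $j<i$. Then $\{l_i,f_i\}$ is a witness set. Furthermore, if $w_{l_i}\in I_{f_i}$, then $\{f_i\}$ is a witness set.
   Context: An instance is a connected (multi)graph $G=(V,E)$; each edge $e$ has unknown true weight $w_e\in\mathbb{R}_+$ and known uncertainty interval $I_e$, either open $(L_e,U_e)\ni w_e$ or trivial $\{w_e\}$ (then $L_e=U_e=w_e$). Querying $e$ reveals $w_e$. $Q\subseteq E$ is a feasible query set if some spanning tree is an MST for every weight assignment equal to $w_e$ on $Q$ and arbitrary in $I_e$ outside $Q$; a witness set is $W\subseteq E$ with $W\cap Q\ne\emptyset$ for every feasible query set $Q$. $T_L$ is an MST for weights $L_e+\epsilon$, $T_U$ an MST for weights $U_e-\epsilon$ ($\epsilon>0$ infinitesimal). Let $f_1,\dots,f_l$ be the edges of $E\setminus T_L$ ordered by non-decreasing lower limit, and $C_i$ the unique cycle in $T_L\cup\{f_i\}$.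
   Formalization: The true weights $w_e$, the interval endpoints $L_e$, $U_e$ and the weight assignments in the definition of a feasible query set take values in the rationals rather than the reals. -}

module Defs where

open import Data.Nat using (ℕ; zero; suc)
import Data.Nat as ℕ
open import Data.Fin using (Fin; zero; suc)
import Data.Fin as F
open import Data.Bool using (Bool; true; false)
open import Data.List using (List; []; _∷_; length)
open import Data.Maybe using (Maybe; just; nothing)
open import Data.List.Relation.Unary.Unique.Propositional using (Unique)
open import Data.List.Membership.Propositional using (_∈_)
open import Data.Rational using (ℚ; 0ℚ; _+_; _-_; _≤_; _<_)
open import Data.Product using (Σ; ∃; ∃-syntax; _×_; _,_)
open import Data.Sum using (_⊎_)
open import Data.Empty using (⊥)
open import Relation.Binary.PropositionalEquality using (_≡_; _≢_)
open import Relation.Nullary using (¬_)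

dropHead : ∀ {A : Set} → List A → List A
dropHead []       = []
dropHead (_ ∷ xs) = xs

sumFin : ∀ {m} → (Fin m → ℚ) → ℚ
sumFin {zero}  f = 0ℚ
sumFin {suc m} f = f zero + sumFin (λ i → f (suc i))

module Graph {n m : ℕ} (src tgt : Fin m → Fin n) where

  EdgeSet : Set
  EdgeSet = Fin m → Bool

  allEdges : EdgeSet
  allEdges _ = true

  addEdge : EdgeSet → Fin m → EdgeSet
  addEdge S f e with e F.≟ f
  ... | Relation.Nullary.yes _ = true
  ... | Relation.Nullary.no  _ = S e

  Joins : Fin m → Fin n → Fin n → Set
  Joins e u v = (src e ≡ u × tgt e ≡ v) ⊎ (src e ≡ v × tgt e ≡ u)

  data Walk (S : EdgeSet) : Fin n → Fin n → Set where
    []   : ∀ {v} → Walk S v v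
    step : ∀ {u x v} (e : Fin m) → S e ≡ true → Joins e u x → Walk S x v → Walk S u v

  edgesOf : ∀ {S u v} → Walk S u v → List (Fin m)
  edgesOf []               = []
  edgesOf (step e _ _ p)   = e ∷ edgesOf p

  vertsOf : ∀ {S u v} → Walk S u v → List (Fin n)
  vertsOf {v = v} []           = v ∷ []
  vertsOf {u = u} (step _ _ _ p) = u ∷ vertsOf p

  record Cycle (S : EdgeSet) : Set where
    field
      base      : Fin n
      walk      : Walk S base base
      nonEmpty  : 1 ℕ.≤ length (edgesOf walk)
      edgesUniq : Unique (edgesOf walk)
      vertsUniq : Unique (dropHead (vertsOf walk))

  OnCycle : Fin m → ∀ {S} → Cycle S → Set
  OnCycle e c = e ∈ edgesOf (Cycle.walk c)

  Connected : EdgeSet → Set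
  Connected S = ∀ u v → Walk S u v

  Acyclic : EdgeSet → Set
  Acyclic S = ¬ Cycle S

  IsSpanningTree : EdgeSet → Set
  IsSpanningTree T = Connected T × Acyclic T

  weightOf : (Fin m → ℚ) → EdgeSet → ℚ
  weightOf c T = sumFin (λ e → sel (T e) (c e))
    where
    sel : Bool → ℚ → ℚ
    sel true  q = q
    sel false _ = 0ℚ

  IsMST : (Fin m → ℚ) → EdgeSet → Set
  IsMST c T = IsSpanningTree T × (∀ T' → IsSpanningTree T' → weightOf c T ≤ weightOf c T')

  SameSet : EdgeSet → EdgeSet → Set
  SameSet S S' = ∀ e → S e ≡ S' e

  IsUniqueMST : (Fin m → ℚ) → EdgeSet → Set
  IsUniqueMST c T = IsMST c T × (∀ T' → IsMST c T' → SameSet T' T)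

  InCycleOf : EdgeSet → Fin m → Fin m → Set
  InCycleOf T f e = Σ (Cycle (addEdge T f)) (OnCycle e)

record Instance : Set where
  field
    n m        : ℕ
    src tgt    : Fin m → Fin n
    connected  : Graph.Connected src tgt (Graph.allEdges src tgt)
    -- uncertainty intervals: trivial e = true means I_e = {L e} (= {U e});
    -- otherwise I_e is the open interval (L e , U e)
    L U        : Fin m → ℚ
    trivial    : Fin m → Bool
    L-nonneg   : ∀ e → 0ℚ ≤ L e
    trivial-LU : ∀ e → trivial e ≡ true  → L e ≡ U e
    open-LU    : ∀ e → trivial e ≡ false → L e < U e
    w          : Fin m → ℚ

  open Graph src tgt public

  InI : Fin m → ℚ → Set
  InI e x = (trivial e ≡ true × x ≡ L e) ⊎ (trivial e ≡ false × L e < x × x < U e)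

  field
    w-in       : ∀ e → InI e (w e)

  lowerε : ℚ → Fin m → ℚ
  lowerε ε e with trivial e
  ... | true  = L e
  ... | false = L e + ε

  upperε : ℚ → Fin m → ℚ
  upperε ε e with trivial e
  ... | true  = U e
  ... | false = U e - ε

  -- T is the unique lower (upper) limit tree: the unique MST for weights
  -- L_e + ε (U_e - ε) for every sufficiently small ε > 0 (infinitesimal ε)
  IsUniqueLowerLimitTree : EdgeSet → Set
  IsUniqueLowerLimitTree T = ∃[ δ ] (0ℚ < δ × (∀ ε → 0ℚ < ε → ε < δ → IsUniqueMST (lowerε ε) T))

  IsUniqueUpperLimitTree : EdgeSet → Set
  IsUniqueUpperLimitTree T = ∃[ δ ] (0ℚ < δ × (∀ ε → 0ℚ < ε → ε < δ → IsUniqueMST (upperε ε) T))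

  Feasible : EdgeSet → Set
  Feasible Q = ∃[ T ] (∀ (w' : Fin m → ℚ) →
                 (∀ e → Q e ≡ true → w' e ≡ w e) →
                 (∀ e → Q e ≡ false → InI e (w' e)) →
                 IsMST w' T)

  IsWitnessSet : (Fin m → Set) → Set
  IsWitnessSet W = ∀ Q → Feasible Q → ∃[ e ] (W e × Q e ≡ true)

  IsOrderedNonTreeEnum : EdgeSet → (l : ℕ) → (Fin l → Fin m) → Set
  IsOrderedNonTreeEnum T l f =
      (∀ j k → f j ≡ f k → j ≡ k)
    × (∀ e → T e ≡ false → ∃[ j ] f j ≡ e)
    × (∀ j → T (f j) ≡ false)
    × (∀ j k → j F.≤ k → L (f j) ≤ L (f k))

{-# OPTIONS --safe #-}
module Submission where

-- Suppose a feasible query set Q avoids f_i (and, for the first claim, l_i), and let T′ be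
-- the tree it certifies. Give l_i a weight y ∈ I_{l_i} ∩ I_{f_i} (its true weight if l_i ∈ Q;
-- for the first claim any y ∈ (L_{f_i}, U_{l_i}) works, since T = T_L = T_U forces
-- L_{l_i} < L_{f_i} and U_{l_i} < U_{f_i}) and let the weight z of f_i range over I_{f_i}:
-- T′ must remain an MST for every z.
-- If f_i ∈ T′, the cycle C_i crosses the cut of T′ − f_i a second time, at some h ∉ T′, so
-- z ≤ w_h for all z; but w_h < U_{f_i}, since h lies on C_i and T = T_U.
-- If f_i ∉ T′, the path of T′ joining the ends of f_i crosses the cut of T − l_i at some g,
-- so w_g ≤ z for all z; but w_g > L_{f_i}: either g = l_i, or g ∉ T has l_i on its cycle,
-- so g = f_j with j ≥ i, whence L_{f_i} ≤ L_g.

open import Defs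
open import Data.Nat using (ℕ; zero; suc; s≤s; z≤n)
import Data.Nat as ℕ
open import Data.Fin using (Fin; zero; suc)
import Data.Fin as F
open import Data.Bool using (Bool; true; false; if_then_else_)
import Data.Bool as Bool
open import Data.Bool.Properties using (not-¬; ¬-not)
open import Data.List using (List; []; _∷_; allFin; length)
open import Data.List.Relation.Unary.Any using (here; there; any?)
open import Data.List.Relation.Unary.All using ([]; _∷_)
open import Data.List.Relation.Unary.All.Properties using (¬Any⇒All¬; All¬⇒¬Any)
open import Data.List.Relation.Unary.AllPairs using ([]; _∷_)
open import Data.List.Relation.Unary.Unique.Propositional using (Unique)
open import Data.List.Membership.Propositional using (_∈_; _∉_; find; lose)
open import Data.List.Membership.Propositional.Properties using (∈-allFin)
import Data.List.Membership.DecPropositional as DecMembership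
open import Data.Product using (Σ; ∃-syntax; _×_; _,_; proj₁; proj₂)
import Data.Product as Product
open import Data.Sum using (_⊎_; inj₁; inj₂)
import Data.Sum as Sum
open import Function using (_∘_; const; mk⇔)
open import Relation.Binary.PropositionalEquality using (_≡_; _≢_; refl; sym; trans; cong; cong₂; subst; subst₂)
open import Relation.Nullary using (¬_; Dec; yes; no; does; contradiction; ¬?)
open import Relation.Nullary.Decidable using (map′; dec-true; dec-false; does-⇔; decidable-stable; _×-dec_)

module Multigraphs {n m : ℕ} (src tgt : Fin m → Fin n) where
  open Graph src tgt
  open DecMembership (F._≟_ {n}) using () renaming (_∈?_ to _∈ᵛ?_)
  open DecMembership (F._≟_ {m}) using () renaming (_∈?_ to _∈ᵉ?_)

  infix 4 _⊆_
  _⊆_ : EdgeSet → EdgeSet → Set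
  S ⊆ S′ = ∀ h → S h ≡ true → S′ h ≡ true

  addEdge-added : ∀ S g → addEdge S g g ≡ true
  addEdge-added S g with g F.≟ g
  ... | yes _  = refl
  ... | no g≢g = contradiction refl g≢g

  addEdge-other : ∀ S {g h} → h ≢ g → addEdge S g h ≡ S h
  addEdge-other S {g} {h} h≢g with h F.≟ g
  ... | yes h≡g = contradiction h≡g h≢g
  ... | no _    = refl

  ⊆-addEdge : ∀ S g → S ⊆ addEdge S g
  ⊆-addEdge S g h h∈S with h F.≟ g
  ... | yes _ = refl
  ... | no _  = h∈S

  ∈-addEdge⁻ : ∀ S {g h} → h ≢ g → addEdge S g h ≡ true → S h ≡ true
  ∈-addEdge⁻ S h≢g h∈S+g = trans (sym (addEdge-other S h≢g)) h∈S+g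

  removeEdge : EdgeSet → Fin m → EdgeSet
  removeEdge S e h with h F.≟ e
  ... | yes _ = false
  ... | no _  = S h

  removeEdge-removed : ∀ S e → removeEdge S e e ≡ false
  removeEdge-removed S e with e F.≟ e
  ... | yes _  = refl
  ... | no e≢e = contradiction refl e≢e

  removeEdge-other : ∀ S {e h} → h ≢ e → removeEdge S e h ≡ S h
  removeEdge-other S {e} {h} h≢e with h F.≟ e
  ... | yes h≡e = contradiction h≡e h≢e
  ... | no _    = refl

  removeEdge-⊆ : ∀ S e → removeEdge S e ⊆ S
  removeEdge-⊆ S e h h∈S∖e with h F.≟ e
  removeEdge-⊆ S e h () | yes _
  ... | no _ = h∈S∖e

  removeEdge-∉ : ∀ S e {g} → S g ≡ false → removeEdge S e g ≡ false
  removeEdge-∉ S e {g} g∉S with g F.≟ e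
  ... | yes _ = refl
  ... | no _  = g∉S

  -- Walks and paths

  infixr 5 _++ʷ_
  _++ʷ_ : ∀ {S u v x} → Walk S u v → Walk S v x → Walk S u x
  []              ++ʷ W′ = W′
  step e e∈S j W ++ʷ W′ = step e e∈S j (W ++ʷ W′)

  joins-sym : ∀ {e u v} → Joins e u v → Joins e v u
  joins-sym (inj₁ (s , t)) = inj₂ (s , t)
  joins-sym (inj₂ (s , t)) = inj₁ (s , t)

  joins-cong : ∀ {A : Set} (c : Fin n → A) {h u x} → c (src h) ≡ c (tgt h) → Joins h u x → c u ≡ c x
  joins-cong c h-ends (inj₁ (refl , refl)) = h-ends
  joins-cong c h-ends (inj₂ (refl , refl)) = sym h-ends

  reverseʷ : ∀ {S u v} → Walk S u v → Walk S v u
  reverseʷ []               = []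
  reverseʷ (step e e∈S j W) = reverseʷ W ++ʷ step e e∈S (joins-sym j) []

  edgeʷ : ∀ {S} h → S h ≡ true → Walk S (src h) (tgt h)
  edgeʷ h h∈S = step h h∈S (inj₁ (refl , refl)) []

  edgesOf-⊆ : ∀ {S u v h} (W : Walk S u v) → h ∈ edgesOf W → S h ≡ true
  edgesOf-⊆ (step _ e∈S _ _) (here refl) = e∈S
  edgesOf-⊆ (step _ _ _ W)   (there h∈W) = edgesOf-⊆ W h∈W

  recast : ∀ {S S′ u v} (W : Walk S u v) → (∀ {h} → h ∈ edgesOf W → S′ h ≡ true) → Walk S′ u v
  recast []             _    = []
  recast (step e _ j W) W⊆S′ = step e (W⊆S′ (here refl)) j (recast W (λ h∈W → W⊆S′ (there h∈W)))

  edgesOf-recast : ∀ {S S′ : EdgeSet} {u v} (W : Walk S u v) (W⊆S′ : ∀ {h} → h ∈ edgesOf W → S′ h ≡ true) →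
                   edgesOf (recast W W⊆S′) ≡ edgesOf W
  edgesOf-recast []             _    = refl
  edgesOf-recast (step e _ _ W) W⊆S′ = cong (e ∷_) (edgesOf-recast W (λ h∈W → W⊆S′ (there h∈W)))

  vertsOf-recast : ∀ {S S′ : EdgeSet} {u v} (W : Walk S u v) (W⊆S′ : ∀ {h} → h ∈ edgesOf W → S′ h ≡ true) →
                   vertsOf (recast W W⊆S′) ≡ vertsOf W
  vertsOf-recast []                     _    = refl
  vertsOf-recast {u = u} (step _ _ _ W) W⊆S′ = cong (u ∷_) (vertsOf-recast W (λ h∈W → W⊆S′ (there h∈W)))

  weaken : ∀ {S S′ u v} → S ⊆ S′ → Walk S u v → Walk S′ u v
  weaken S⊆S′ W = recast W (S⊆S′ _ ∘ edgesOf-⊆ W)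

  IsPath : ∀ {S u v} → Walk S u v → Set
  IsPath W = Unique (vertsOf W)

  start∈vertsOf : ∀ {S u v} (W : Walk S u v) → u ∈ vertsOf W
  start∈vertsOf []             = here refl
  start∈vertsOf (step _ _ _ _) = here refl

  ends∈vertsOf : ∀ {S u v h} (W : Walk S u v) → h ∈ edgesOf W → src h ∈ vertsOf W × tgt h ∈ vertsOf W
  ends∈vertsOf (step _ _ (inj₁ (refl , refl)) W) (here refl) = here refl , there (start∈vertsOf W)
  ends∈vertsOf (step _ _ (inj₂ (refl , refl)) W) (here refl) = there (start∈vertsOf W) , here refl
  ends∈vertsOf (step _ _ _ W)                    (there h∈W) = Product.map there there (ends∈vertsOf W h∈W)

  suffixPath : ∀ {S u v x} (P : Walk S u v) → IsPath P → x ∈ vertsOf P → Σ (Walk S x v) IsPath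
  suffixPath []               P-path       (here refl) = [] , P-path
  suffixPath (step e e∈S j P) P-path       (here refl) = step e e∈S j P , P-path
  suffixPath (step _ _ _ P)   (_ ∷ P-path) (there x∈P) = suffixPath P P-path x∈P

  toPath : ∀ {S u v} → Walk S u v → Σ (Walk S u v) IsPath
  toPath []                       = [] , [] ∷ []
  toPath {u = u} (step e e∈S j W) with toPath W
  ... | P , P-path with u ∈ᵛ? vertsOf P
  ...   | yes u∈P = suffixPath P P-path u∈P
  ...   | no u∉P  = step e e∈S j P , ¬Any⇒All¬ _ u∉P ∷ P-path

  joins-∉ : ∀ {S e u x v} → Joins e u x → (P : Walk S x v) → u ∉ vertsOf P → e ∉ edgesOf P
  joins-∉ (inj₁ (refl , refl)) P u∉P e∈P = u∉P (proj₁ (ends∈vertsOf P e∈P))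
  joins-∉ (inj₂ (refl , refl)) P u∉P e∈P = u∉P (proj₂ (ends∈vertsOf P e∈P))

  path⇒edgesUnique : ∀ {S u v} (P : Walk S u v) → IsPath P → Unique (edgesOf P)
  path⇒edgesUnique []             _              = []
  path⇒edgesUnique (step e _ j P) (u∉P ∷ P-path) =
    ¬Any⇒All¬ _ (joins-∉ j P (All¬⇒¬Any u∉P)) ∷ path⇒edgesUnique P P-path

  -- Cycles

  closePath : ∀ {S S′ g} → S ⊆ S′ → S′ g ≡ true → (P : Walk S (tgt g) (src g)) → IsPath P → g ∉ edgesOf P →
              Cycle S′
  closePath {g = g} S⊆S′ g∈S′ P P-path g∉P = record
    { base      = src g
    ; walk      = step g g∈S′ (inj₁ (refl , refl)) (weaken S⊆S′ P)
    ; nonEmpty  = s≤s z≤n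
    ; edgesUniq = ¬Any⇒All¬ _ (g∉P ∘ subst (g ∈_) edges≡) ∷ subst Unique (sym edges≡) (path⇒edgesUnique P P-path)
    ; vertsUniq = subst Unique (sym (vertsOf-recast P _)) P-path
    }
    where
    edges≡ : edgesOf (weaken S⊆S′ P) ≡ edgesOf P
    edges≡ = edgesOf-recast P _

  onClosePath : ∀ {S S′ g h} (S⊆S′ : S ⊆ S′) (g∈S′ : S′ g ≡ true) (P : Walk S (tgt g) (src g))
                (P-path : IsPath P) (g∉P : g ∉ edgesOf P) →
                h ∈ edgesOf P → OnCycle h (closePath S⊆S′ g∈S′ P P-path g∉P)
  onClosePath _ _ P _ _ h∈P = there (subst (_ ∈_) (sym (edgesOf-recast P _)) h∈P)

  recastCycle : ∀ {S S′} (C : Cycle S) → (∀ {h} → OnCycle h C → S′ h ≡ true) → Cycle S′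
  recastCycle C C⊆S′ = record
    { base      = Cycle.base C
    ; walk      = recast W C⊆S′
    ; nonEmpty  = subst (λ hs → 1 ℕ.≤ length hs) (sym (edgesOf-recast W C⊆S′)) (Cycle.nonEmpty C)
    ; edgesUniq = subst Unique (sym (edgesOf-recast W C⊆S′)) (Cycle.edgesUniq C)
    ; vertsUniq = subst (Unique ∘ dropHead) (sym (vertsOf-recast W C⊆S′)) (Cycle.vertsUniq C)
    }
    where
    W : Walk _ (Cycle.base C) (Cycle.base C)
    W = Cycle.walk C

  acyclic-⊆ : ∀ {S S′} → S ⊆ S′ → Acyclic S′ → Acyclic S
  acyclic-⊆ S⊆S′ S′-acyclic C = S′-acyclic (recastCycle C (S⊆S′ _ ∘ edgesOf-⊆ (Cycle.walk C)))

  onCycle-added : ∀ {S g} → Acyclic S → (C : Cycle (addEdge S g)) → OnCycle g C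
  onCycle-added {S} {g} S-acyclic C with g ∈ᵉ? edgesOf (Cycle.walk C)
  ... | yes g∈C = g∈C
  ... | no g∉C  = contradiction (recastCycle C C⊆S) S-acyclic
    where
    C⊆S : ∀ {h} → OnCycle h C → S h ≡ true
    C⊆S h∈C = ∈-addEdge⁻ S (λ { refl → g∉C h∈C }) (edgesOf-⊆ (Cycle.walk C) h∈C)

  -- Reachability

  relabel : (Fin n → Fin n) → Fin n → Fin n → Fin n → Fin n
  relabel c s t v with c v F.≟ c t
  ... | yes _ = c s
  ... | no _  = c v

  relabel-cong : ∀ c s t {u v} → c u ≡ c v → relabel c s t u ≡ relabel c s t v
  relabel-cong c s t {u} {v} u~v with c u F.≟ c t | c v F.≟ c t
  ... | yes _   | yes _   = refl
  ... | yes u~t | no v≁t  = contradiction (trans (sym u~v) u~t) v≁t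
  ... | no u≁t  | yes v~t = contradiction (trans u~v v~t) u≁t
  ... | no _    | no _    = u~v

  relabel-merges : ∀ c s t → relabel c s t s ≡ relabel c s t t
  relabel-merges c s t with c s F.≟ c t | c t F.≟ c t
  ... | _     | no t≁t = contradiction refl t≁t
  ... | yes _ | yes _  = refl
  ... | no _  | yes _  = refl

  -- labels S hs names every vertex by a representative of its component in the edges of S
  -- listed in hs, merging the two classes at the ends of each such edge in turn.
  labels : EdgeSet → List (Fin m) → Fin n → Fin n
  labels S []       v = v
  labels S (h ∷ hs) v = if S h then relabel (labels S hs) (src h) (tgt h) v else labels S hs v

  labels-edge : ∀ S {hs h} → h ∈ hs → S h ≡ true → labels S hs (src h) ≡ labels S hs (tgt h)
  labels-edge S {h ∷ hs} (here refl) h∈S rewrite h∈S = relabel-merges (labels S hs) (src h) (tgt h)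
  labels-edge S {h′ ∷ hs} (there h∈hs) h∈S with S h′
  ... | true  = relabel-cong (labels S hs) (src h′) (tgt h′) (labels-edge S h∈hs h∈S)
  ... | false = labels-edge S h∈hs h∈S

  labels⇒walk : ∀ S hs {u v} → labels S hs u ≡ labels S hs v → Walk S u v
  labels⇒walk S []       refl = []
  labels⇒walk S (h ∷ hs) {u} {v} u~v with S h in h∈S
  ... | false = labels⇒walk S hs u~v
  ... | true with labels S hs u F.≟ labels S hs (tgt h) | labels S hs v F.≟ labels S hs (tgt h)
  ...   | yes u~t | yes v~t = labels⇒walk S hs (trans u~t (sym v~t))
  ...   | yes u~t | no _    = labels⇒walk S hs u~t ++ʷ reverseʷ (edgeʷ h h∈S) ++ʷ labels⇒walk S hs u~v
  ...   | no _    | yes v~t = labels⇒walk S hs u~v ++ʷ edgeʷ h h∈S ++ʷ labels⇒walk S hs (sym v~t)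
  ...   | no _    | no _    = labels⇒walk S hs u~v

  component : EdgeSet → Fin n → Fin n
  component S = labels S (allFin m)

  walk⇒component : ∀ S {u v} → Walk S u v → component S u ≡ component S v
  walk⇒component S []               = refl
  walk⇒component S (step h h∈S j W) =
    trans (joins-cong (component S) (labels-edge S (∈-allFin h) h∈S) j) (walk⇒component S W)

  reachable? : ∀ S u v → Dec (Walk S u v)
  reachable? S u v = map′ (labels⇒walk S (allFin m)) (walk⇒component S) (component S u F.≟ component S v)

  -- Cuts

  SameSide : (Fin n → Bool) → Fin m → Set
  SameSide σ h = σ (src h) ≡ σ (tgt h)

  Crosses : (Fin n → Bool) → Fin m → Set
  Crosses σ h = ¬ SameSide σ h

  joins-crosses : ∀ σ {h u x} → Crosses σ h → Joins h u x → σ u ≢ σ x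
  joins-crosses σ h-crosses (inj₁ (refl , refl)) = h-crosses
  joins-crosses σ h-crosses (inj₂ (refl , refl)) = h-crosses ∘ sym

  sameSide-walk : ∀ {S u v} σ (W : Walk S u v) → (∀ {h} → h ∈ edgesOf W → SameSide σ h) → σ u ≡ σ v
  sameSide-walk σ []             _      = refl
  sameSide-walk σ (step h _ j W) W-same =
    trans (joins-cong σ (W-same (here refl)) j) (sameSide-walk σ W (λ h∈W → W-same (there h∈W)))

  crossesOnce-walk : ∀ {S u v g} σ (W : Walk S u v) → Unique (edgesOf W) → g ∈ edgesOf W → Crosses σ g →
                     (∀ {h} → h ∈ edgesOf W → h ≢ g → SameSide σ h) → σ u ≢ σ v
  crossesOnce-walk σ (step g _ j W) (g∉W ∷ _) (here refl) g-crosses others u~v =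
    joins-crosses σ g-crosses j (trans u~v (sym (sameSide-walk σ W W-same)))
    where
    W-same : ∀ {h} → h ∈ edgesOf W → SameSide σ h
    W-same h∈W = others (there h∈W) (λ { refl → All¬⇒¬Any g∉W h∈W })
  crossesOnce-walk σ (step h _ j W) (h∉W ∷ W-unique) (there g∈W) g-crosses others u~v =
    crossesOnce-walk σ W W-unique g∈W g-crosses (others ∘ there)
      (trans (sym (joins-cong σ (others (here refl) h≢g) j)) u~v)
    where
    h≢g : h ≢ _
    h≢g refl = All¬⇒¬Any h∉W g∈W

  crossing-edge : ∀ {S u v} σ (W : Walk S u v) → σ u ≢ σ v → ∃[ h ] (h ∈ edgesOf W × Crosses σ h)
  crossing-edge σ []             u≁v = contradiction refl u≁v
  crossing-edge σ (step h _ j W) u≁v with σ (src h) Bool.≟ σ (tgt h)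
  ... | no h-crosses = h , here refl , h-crosses
  ... | yes h-same with crossing-edge σ W (u≁v ∘ trans (joins-cong σ h-same j))
  ...   | h′ , h′∈W , h′-crosses = h′ , there h′∈W , h′-crosses

  crossesBesides? : ∀ σ g h → Dec (h ≢ g × Crosses σ h)
  crossesBesides? σ g h = ¬? (h F.≟ g) ×-dec ¬? (σ (src h) Bool.≟ σ (tgt h))

  cycle-crossesTwice : ∀ {S g} σ (C : Cycle S) → OnCycle g C → Crosses σ g →
                       ∃[ h ] (OnCycle h C × h ≢ g × Crosses σ h)
  cycle-crossesTwice {g = g} σ C g∈C g-crosses with any? (crossesBesides? σ g) (edgesOf (Cycle.walk C))
  ... | yes found = find found
  ... | no none   =
    contradiction refl (crossesOnce-walk σ (Cycle.walk C) (Cycle.edgesUniq C) g∈C g-crosses others)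
    where
    others : ∀ {h} → OnCycle h C → h ≢ g → SameSide σ h
    others h∈C h≢g = decidable-stable (σ _ Bool.≟ σ _) (λ h-crosses → none (lose h∈C (h≢g , h-crosses)))

  cutSide : EdgeSet → Fin m → Fin n → Bool
  cutSide T e v = does (reachable? (removeEdge T e) (src e) v)

  module FundamentalCut {T : EdgeSet} (T-tree : IsSpanningTree T) {e : Fin m} (e∈T : T e ≡ true) where

    T∖e : EdgeSet
    T∖e = removeEdge T e

    side : Fin n → Bool
    side = cutSide T e

    sameSide-T∖e : ∀ {h} → T∖e h ≡ true → SameSide side h
    sameSide-T∖e {h} h∈T∖e =
      does-⇔ (mk⇔ (_++ʷ edgeʷ h h∈T∖e) (_++ʷ reverseʷ (edgeʷ h h∈T∖e))) (reachable? _ _ _) (reachable? _ _ _)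

    sameSide-T : ∀ {h} → T h ≡ true → h ≢ e → SameSide side h
    sameSide-T h∈T h≢e = sameSide-T∖e (trans (removeEdge-other T h≢e) h∈T)

    tgt-unreachable : ¬ Walk T∖e (src e) (tgt e)
    tgt-unreachable W with toPath (reverseʷ W)
    ... | P , P-path = proj₂ T-tree (closePath (removeEdge-⊆ T e) e∈T P P-path e∉P)
      where
      e∉P : e ∉ edgesOf P
      e∉P e∈P = not-¬ (edgesOf-⊆ P e∈P) (removeEdge-removed T e)

    e-crosses : Crosses side e
    e-crosses src~tgt = not-¬ (dec-true (reachable? T∖e (src e) (src e)) [])
                              (trans src~tgt (dec-false (reachable? T∖e (src e) (tgt e)) tgt-unreachable))

    crossesOnce-treeWalk : ∀ {u v} (W : Walk T u v) → Unique (edgesOf W) → e ∈ edgesOf W → side u ≢ side v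
    crossesOnce-treeWalk W W-unique e∈W =
      crossesOnce-walk side W W-unique e∈W e-crosses (sameSide-T ∘ edgesOf-⊆ W)

    cycleEdge-crosses : ∀ {g} (C : Cycle (addEdge T g)) → OnCycle e C → Crosses side g
    cycleEdge-crosses {g} C e∈C g-same =
      crossesOnce-walk side (Cycle.walk C) (Cycle.edgesUniq C) e∈C e-crosses others refl
      where
      others : ∀ {h} → OnCycle h C → h ≢ e → SameSide side h
      others {h} h∈C h≢e with h F.≟ g
      ... | yes refl = g-same
      ... | no h≢g   = sameSide-T (∈-addEdge⁻ T h≢g (edgesOf-⊆ (Cycle.walk C) h∈C)) h≢e

    fundamentalCycle : ∀ {g} → T g ≡ false → Crosses side g → InCycleOf T g e
    fundamentalCycle {g} g∉T g-crosses with toPath (proj₁ T-tree (tgt g) (src g))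
    ... | P , P-path with e ∈ᵉ? edgesOf P
    ...   | yes e∈P = closePath (⊆-addEdge T g) (addEdge-added T g) P P-path g∉P
                    , onClosePath (⊆-addEdge T g) (addEdge-added T g) P P-path g∉P e∈P
      where
      g∉P : g ∉ edgesOf P
      g∉P g∈P = not-¬ (edgesOf-⊆ P g∈P) g∉T
    ...   | no e∉P  = contradiction (sym (sameSide-walk side P P-same)) g-crosses
      where
      P-same : ∀ {h} → h ∈ edgesOf P → SameSide side h
      P-same h∈P = sameSide-T (edgesOf-⊆ P h∈P) (λ { refl → e∉P h∈P })

    Reached : Fin n → Set
    Reached v = Walk T∖e (src e) v ⊎ Walk T∖e (tgt e) v

    reached-e : ∀ {x y} → Joins e x y → Reached y
    reached-e (inj₁ (refl , refl)) = inj₂ []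
    reached-e (inj₂ (refl , refl)) = inj₁ []

    reached-step : ∀ {h x y} → T h ≡ true → Joins h x y → Reached x → Reached y
    reached-step {h} {x} {y} h∈T j x-reached with h F.≟ e
    ... | yes refl = reached-e j
    ... | no h≢e   = Sum.map (_++ʷ hop) (_++ʷ hop) x-reached
      where
      hop : Walk T∖e x y
      hop = step h (trans (removeEdge-other T h≢e) h∈T) j []

    reached : ∀ v → Reached v
    reached v = reached-walk (proj₁ T-tree (src e) v) (inj₁ [])
      where
      reached-walk : ∀ {x v} → Walk T x v → Reached x → Reached v
      reached-walk []               x-reached = x-reached
      reached-walk (step h h∈T j W) x-reached = reached-walk W (reached-step h∈T j x-reached)

    srcSide-walk : ∀ {v} → side v ≡ true → Walk T∖e (src e) v
    srcSide-walk {v} v-side =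
      decidable-stable (reachable? T∖e (src e) v) (not-¬ v-side ∘ dec-false (reachable? T∖e (src e) v))

    tgtSide-walk : ∀ {v} → side v ≡ false → Walk T∖e (tgt e) v
    tgtSide-walk {v} v-side with reached v
    ... | inj₁ W = contradiction v-side (not-¬ (dec-true (reachable? T∖e (src e) v) W))
    ... | inj₂ W = W

    module _ {g : Fin m} (g-crosses : Crosses side g) where

      lift : ∀ {u v} → Walk T∖e u v → Walk (addEdge T∖e g) u v
      lift = weaken (⊆-addEdge T∖e g)

      across : Walk (addEdge T∖e g) (tgt e) (src e)
      across = acrossFrom (side (src g)) (side (tgt g)) refl refl
        where
        acrossFrom : ∀ a b → side (src g) ≡ a → side (tgt g) ≡ b → Walk (addEdge T∖e g) (tgt e) (src e)
        acrossFrom true  false s t = lift (tgtSide-walk t)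
                                     ++ʷ reverseʷ (edgeʷ g (addEdge-added T∖e g))
                                     ++ʷ lift (reverseʷ (srcSide-walk s))
        acrossFrom false true  s t = lift (tgtSide-walk s)
                                     ++ʷ edgeʷ g (addEdge-added T∖e g)
                                     ++ʷ lift (reverseʷ (srcSide-walk t))
        acrossFrom true  true  s t = contradiction (trans s (sym t)) g-crosses
        acrossFrom false false s t = contradiction (trans s (sym t)) g-crosses

      toSrc : ∀ v → Walk (addEdge T∖e g) v (src e)
      toSrc v with side v in v-side
      ... | true  = lift (reverseʷ (srcSide-walk v-side))
      ... | false = lift (reverseʷ (tgtSide-walk v-side)) ++ʷ across

      exchange-isSpanningTree : IsSpanningTree (addEdge T∖e g)
      exchange-isSpanningTree = (λ u v → toSrc u ++ʷ reverseʷ (toSrc v)) , acyclic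
        where
        acyclic : Acyclic (addEdge T∖e g)
        acyclic C = crossesOnce-walk side (Cycle.walk C) (Cycle.edgesUniq C) g∈C g-crosses others refl
          where
          g∈C : OnCycle g C
          g∈C = onCycle-added (acyclic-⊆ (removeEdge-⊆ T e) (proj₂ T-tree)) C
          others : ∀ {h} → OnCycle h C → h ≢ g → SameSide side h
          others h∈C h≢g = sameSide-T∖e (∈-addEdge⁻ T∖e h≢g (edgesOf-⊆ (Cycle.walk C) h∈C))

module RationalFacts where
  open import Data.Rational using (ℚ; 0ℚ; _+_; _-_; -_; _≤_; _<_)
  open import Data.Rational.Properties
    using (+-comm; +-identityʳ; +-inverseʳ; +-monoʳ-≤; +-monoʳ-<; +-monoˡ-<; neg-antimono-<;
           <-dense; ≤-total; _≤?_; ≰⇒>; <-trans; <-≤-trans; ≤-<-trans; <-irrefl)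
  open import Data.Rational.Solver using (module +-*-Solver)
  open +-*-Solver using (solve; _:+_; _:-_; :-_; _:=_)

  -r+[r+p]≡p : ∀ r p → - r + (r + p) ≡ p
  -r+[r+p]≡p = solve 2 (λ r p → :- r :+ (r :+ p) := p) refl

  +-cancelˡ-≤ : ∀ r {p q} → r + p ≤ r + q → p ≤ q
  +-cancelˡ-≤ r {p} {q} r+p≤r+q = subst₂ _≤_ (-r+[r+p]≡p r p) (-r+[r+p]≡p r q) (+-monoʳ-≤ (- r) r+p≤r+q)

  +-cancelˡ-< : ∀ r {p q} → r + p < r + q → p < q
  +-cancelˡ-< r {p} {q} r+p<r+q = subst₂ _<_ (-r+[r+p]≡p r p) (-r+[r+p]≡p r q) (+-monoʳ-< (- r) r+p<r+q)

  +-cancelʳ-< : ∀ r {p q} → p + r < q + r → p < q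
  +-cancelʳ-< r {p} {q} p+r<q+r = +-cancelˡ-< r (subst₂ _<_ (+-comm p r) (+-comm q r) p+r<q+r)

  p<p+ε : ∀ p {ε} → 0ℚ < ε → p < p + ε
  p<p+ε p {ε} ε>0 = subst (_< p + ε) (+-identityʳ p) (+-monoʳ-< p ε>0)

  p-ε<p : ∀ p {ε} → 0ℚ < ε → p - ε < p
  p-ε<p p {ε} ε>0 = subst (p - ε <_) (+-identityʳ p) (+-monoʳ-< p (neg-antimono-< ε>0))

  p-ε<q⇒p<q+ε : ∀ {p q} ε → p - ε < q → p < q + ε
  p-ε<q⇒p<q+ε {p} ε p-ε<q = subst (_< _) (solve 2 (λ p ε → (p :- ε) :+ ε := p) refl p ε) (+-monoˡ-< ε p-ε<q)

  dense-above : ∀ {p q r} → p < r → q < r → ∃[ z ] (p < z × q < z × z < r)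
  dense-above {p} {q} p<r q<r with ≤-total p q
  ... | inj₁ p≤q = let z , q<z , z<r = <-dense q<r in z , ≤-<-trans p≤q q<z , q<z , z<r
  ... | inj₂ q≤p = let z , p<z , z<r = <-dense p<r in z , p<z , ≤-<-trans q≤p p<z , z<r

  dense-below : ∀ {p q r} → p < q → p < r → ∃[ z ] (p < z × z < q × z < r)
  dense-below {p} {q} {r} p<q p<r with ≤-total q r
  ... | inj₁ q≤r = let z , p<z , z<q = <-dense p<q in z , p<z , z<q , <-≤-trans z<q q≤r
  ... | inj₂ r≤q = let z , p<z , z<r = <-dense p<r in z , p<z , <-≤-trans z<r r≤q , z<r

  ≤-fromSlack : ∀ {δ p q} → 0ℚ < δ → (∀ ε → 0ℚ < ε → ε < δ → p < q + ε) → p ≤ q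
  ≤-fromSlack {δ} {p} {q} δ>0 slack with p ≤? q
  ... | yes p≤q = p≤q
  ... | no p≰q with dense-below δ>0 (subst (_< p - q) (+-inverseʳ q) (+-monoˡ-< (- q) (≰⇒> p≰q)))
  ...   | ε , ε>0 , ε<δ , ε<p-q = contradiction (<-trans (slack ε ε>0 ε<δ) q+ε<p) (<-irrefl refl)
    where
    q+ε<p : q + ε < p
    q+ε<p = subst (q + ε <_) (solve 2 (λ p q → q :+ (p :- q) := p) refl p q) (+-monoʳ-< q ε<p-q)

  unbounded-above : ∀ {p q a} → p < q → a < q → ¬ (∀ z → p < z → z < q → z ≤ a)
  unbounded-above p<q a<q below-a with dense-above p<q a<q
  ... | z , p<z , a<z , z<q = <-irrefl refl (≤-<-trans (below-a z p<z z<q) a<z)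

  unbounded-below : ∀ {p q a} → p < q → p < a → ¬ (∀ z → p < z → z < q → a ≤ z)
  unbounded-below p<q p<a above-a with dense-below p<a p<q
  ... | z , p<z , z<a , z<q = <-irrefl refl (≤-<-trans (above-a z p<z z<q) z<a)

module FiniteSums where
  open import Data.Rational using (ℚ; _+_)
  open import Data.Rational.Properties using (+-assoc)
  open import Data.Rational.Solver using (module +-*-Solver)
  open +-*-Solver using (solve; _:+_; _:=_)
  import Data.Fin.Properties as Fin
  open import Relation.Binary.PropositionalEquality using (module ≡-Reasoning)
  open ≡-Reasoning

  sumFin-cong : ∀ {k} {a b : Fin k → ℚ} → (∀ i → a i ≡ b i) → sumFin a ≡ sumFin b
  sumFin-cong {zero}  _   = refl
  sumFin-cong {suc k} a≗b = cong₂ _+_ (a≗b zero) (sumFin-cong (a≗b ∘ suc))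

  sumFin-exchange : ∀ {k} (a b : Fin k → ℚ) g → (∀ {h} → h ≢ g → a h ≡ b h) → sumFin a + b g ≡ sumFin b + a g
  sumFin-exchange a b zero a≈b = begin
    (a zero + sumFin (a ∘ suc)) + b zero ≡⟨ cong (λ t → (a zero + t) + b zero) tail≡ ⟩
    (a zero + sumFin (b ∘ suc)) + b zero ≡⟨ swap (a zero) _ (b zero) ⟩
    (b zero + sumFin (b ∘ suc)) + a zero ∎
    where
    tail≡ : sumFin (a ∘ suc) ≡ sumFin (b ∘ suc)
    tail≡ = sumFin-cong (λ i → a≈b {suc i} λ ())
    swap : ∀ x t y → (x + t) + y ≡ (y + t) + x
    swap = solve 3 (λ x t y → (x :+ t) :+ y := (y :+ t) :+ x) refl
  sumFin-exchange a b (suc g) a≈b = begin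
    (a zero + sumFin (a ∘ suc)) + b (suc g) ≡⟨ +-assoc (a zero) _ _ ⟩
    a zero + (sumFin (a ∘ suc) + b (suc g)) ≡⟨ cong₂ _+_ (a≈b {zero} λ ()) (sumFin-exchange _ _ g tail≈) ⟩
    b zero + (sumFin (b ∘ suc) + a (suc g)) ≡⟨ +-assoc (b zero) _ _ ⟨
    (b zero + sumFin (b ∘ suc)) + a (suc g) ∎
    where
    tail≈ : ∀ {h} → h ≢ g → a (suc h) ≡ b (suc h)
    tail≈ h≢g = a≈b (h≢g ∘ Fin.suc-injective)

module SpanningTreeExchange {n m : ℕ} (src tgt : Fin m → Fin n) where
  open Graph src tgt
  open Multigraphs src tgt
  open RationalFacts
  open FiniteSums
  open import Data.Rational using (ℚ; 0ℚ; _+_; _≤_; _<_)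
  open import Data.Rational.Properties using (+-identityʳ; +-monoˡ-≤; +-monoˡ-<; ≤-trans; _≤?_; ≰⇒>)
  open import Data.Rational.Solver using (module +-*-Solver)
  open +-*-Solver using (solve; _:+_; _:=_)
  open import Relation.Binary.PropositionalEquality using (module ≡-Reasoning)
  open ≡-Reasoning

  restrict : EdgeSet → (Fin m → ℚ) → Fin m → ℚ
  restrict S c e = if S e then c e else 0ℚ

  -- The summand of weightOf is local to Defs, so summand≡ leaves it to unification: the
  -- use of summand≡ in weightOf≡ fixes it before the clauses of summand≡ are checked.
  weightOf-restrict : ∀ c S → weightOf c S ≡ sumFin (restrict S c)
  weightOf-restrict c S = weightOf≡
    where
    summand≡ : ∀ e → _ ≡ restrict S c e
    weightOf≡ : weightOf c S ≡ sumFin (restrict S c)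
    weightOf≡ = sumFin-cong summand≡
    summand≡ e with S e
    ... | true  = refl
    ... | false = refl

  weightOf-insert : ∀ c {S S′ g} → (∀ {h} → h ≢ g → S h ≡ S′ h) → S g ≡ false → S′ g ≡ true →
                    weightOf c S + c g ≡ weightOf c S′
  weightOf-insert c {S} {S′} {g} agree g∉S g∈S′ = begin
    weightOf c S + c g                      ≡⟨ cong₂ _+_ (weightOf-restrict c S) (sym (cong (select g) g∈S′)) ⟩
    sumFin (restrict S c) + restrict S′ c g ≡⟨ sumFin-exchange _ _ g (λ {h} h≢g → cong (select h) (agree h≢g)) ⟩
    sumFin (restrict S′ c) + restrict S c g ≡⟨ cong₂ _+_ (sym (weightOf-restrict c S′)) (cong (select g) g∉S) ⟩
    weightOf c S′ + 0ℚ                      ≡⟨ +-identityʳ _ ⟩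
    weightOf c S′                           ∎
    where
    select : Fin m → Bool → ℚ
    select h b = if b then c h else 0ℚ

  weightOf-exchange : ∀ c T {e g} → T e ≡ true → T g ≡ false →
                      weightOf c (addEdge (removeEdge T e) g) + c e ≡ weightOf c T + c g
  weightOf-exchange c T {e} {g} e∈T g∉T = begin
    weightOf c (addEdge T∖e g) + c e ≡⟨ cong (_+ c e) insert-g ⟨
    (weightOf c T∖e + c g) + c e     ≡⟨ swap (weightOf c T∖e) (c g) (c e) ⟩
    (weightOf c T∖e + c e) + c g     ≡⟨ cong (_+ c g) insert-e ⟩
    weightOf c T + c g               ∎
    where
    T∖e : EdgeSet
    T∖e = removeEdge T e
    insert-g : weightOf c T∖e + c g ≡ weightOf c (addEdge T∖e g)
    insert-g = weightOf-insert c (sym ∘ addEdge-other T∖e) (removeEdge-∉ T e g∉T) (addEdge-added T∖e g)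
    insert-e : weightOf c T∖e + c e ≡ weightOf c T
    insert-e = weightOf-insert c (removeEdge-other T) (removeEdge-removed T e) e∈T
    swap : ∀ x y z → (x + y) + z ≡ (x + z) + y
    swap = solve 3 (λ x y z → (x :+ y) :+ z := (x :+ z) :+ y) refl

  module _ (c : Fin m → ℚ) {T : EdgeSet} where

    exchange-≤ : IsMST c T → ∀ {e g} → T e ≡ true → T g ≡ false → Crosses (cutSide T e) g → c e ≤ c g
    exchange-≤ (T-tree , T-minimal) {e} {g} e∈T g∉T g-crosses =
      +-cancelˡ-≤ (weightOf c T) (subst (weightOf c T + c e ≤_) (weightOf-exchange c T e∈T g∉T)
        (+-monoˡ-≤ (c e) (T-minimal _ (FundamentalCut.exchange-isSpanningTree T-tree e∈T g-crosses))))

    exchange-< : IsUniqueMST c T → ∀ {e g} → T e ≡ true → T g ≡ false → Crosses (cutSide T e) g → c e < c g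
    exchange-< ((T-tree , T-minimal) , T-unique) {e} {g} e∈T g∉T g-crosses =
      +-cancelˡ-< (weightOf c T) (subst (weightOf c T + c e <_) (weightOf-exchange c T e∈T g∉T)
        (+-monoˡ-< (c e) T-lighter))
      where
      T′ : EdgeSet
      T′ = addEdge (removeEdge T e) g
      T-lighter : weightOf c T < weightOf c T′
      T-lighter with weightOf c T′ ≤? weightOf c T
      ... | no T′≰T  = ≰⇒> T′≰T
      ... | yes T′≤T = contradiction (trans (sym (addEdge-added _ g)) (T-unique T′ T′-mst g)) (not-¬ g∉T ∘ sym)
        where
        T′-mst : IsMST c T′
        T′-mst = FundamentalCut.exchange-isSpanningTree T-tree e∈T g-crosses
               , λ T″ T″-tree → ≤-trans T′≤T (T-minimal T″ T″-tree)

    uniqueMST-cycle-< : IsUniqueMST c T → ∀ {g h} → T g ≡ false → (C : Cycle (addEdge T g)) → OnCycle h C →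
                        T h ≡ true → c h < c g
    uniqueMST-cycle-< T-umst g∉T C h∈C h∈T =
      exchange-< T-umst h∈T g∉T (FundamentalCut.cycleEdge-crosses (proj₁ (proj₁ T-umst)) h∈T C h∈C)

module LimitTrees (G : Instance) where
  open Instance G
  open Multigraphs src tgt
  open SpanningTreeExchange src tgt
  open RationalFacts
  open import Data.Rational using (ℚ; 0ℚ; -_; _≤_; _<_)
  open import Data.Rational.Properties using (<⇒≤; <-trans; <-dense)

  IsUniqueLimitTree : (ℚ → Fin m → ℚ) → EdgeSet → Set
  IsUniqueLimitTree perturbed T = ∃[ δ ] (0ℚ < δ × (∀ ε → 0ℚ < ε → ε < δ → IsUniqueMST (perturbed ε) T))

  BelowInLimit : (ℚ → Fin m → ℚ) → Fin m → Fin m → Set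
  BelowInLimit perturbed h g = ∃[ δ ] (0ℚ < δ × (∀ ε → 0ℚ < ε → ε < δ → perturbed ε h < perturbed ε g))

  limitTree-isSpanningTree : ∀ {perturbed T} → IsUniqueLimitTree perturbed T → IsSpanningTree T
  limitTree-isSpanningTree (δ , δ>0 , T-unique) =
    let ε , ε>0 , ε<δ = <-dense δ>0 in proj₁ (proj₁ (T-unique ε ε>0 ε<δ))

  limitTree-cycle-below : ∀ perturbed {T g h} → IsUniqueLimitTree perturbed T → T g ≡ false →
                          (C : Cycle (addEdge T g)) → OnCycle h C → h ≢ g → BelowInLimit perturbed h g
  limitTree-cycle-below perturbed {T} {h = h} (δ , δ>0 , T-unique) g∉T C h∈C h≢g =
    δ , δ>0 , λ ε ε>0 ε<δ → uniqueMST-cycle-< (perturbed ε) (T-unique ε ε>0 ε<δ) g∉T C h∈C h∈T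
    where
    h∈T : T h ≡ true
    h∈T = ∈-addEdge⁻ T h≢g (edgesOf-⊆ (Cycle.walk C) h∈C)

  private
    strict : ∀ {A : Set} {p q} → p < q → p ≤ q × (A → p < q)
    strict p<q = <⇒≤ p<q , const p<q

  -- Splitting on trivial h and trivial g lets the perturbed weights in below compute,
  -- e.g. to L h + ε and L g + ε when both intervals are open.
  lowerLimit-order : ∀ {h g} → BelowInLimit lowerε h g →
                     L h ≤ L g × (trivial h ≡ false ⊎ trivial g ≡ true → L h < L g)
  lowerLimit-order {h} {g} (δ , δ>0 , below) with <-dense δ>0
  ... | ε , ε>0 , ε<δ with trivial h | trivial g
  ... | false | false = strict (+-cancelʳ-< ε (below ε ε>0 ε<δ))
  ... | false | true  = strict (<-trans (p<p+ε (L h) ε>0) (below ε ε>0 ε<δ))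
  ... | true  | true  = strict (below ε ε>0 ε<δ)
  ... | true  | false = ≤-fromSlack δ>0 below , λ { (inj₁ ()) ; (inj₂ ()) }

  lowerLimit-≤ : ∀ {h g} → BelowInLimit lowerε h g → L h ≤ L g
  lowerLimit-≤ = proj₁ ∘ lowerLimit-order

  lowerLimit-< : ∀ {h g} → BelowInLimit lowerε h g → trivial h ≡ false ⊎ trivial g ≡ true → L h < L g
  lowerLimit-< = proj₂ ∘ lowerLimit-order

  upperLimit-order : ∀ {h g} → BelowInLimit upperε h g →
                     U h ≤ U g × (trivial g ≡ false ⊎ trivial h ≡ true → U h < U g)
  upperLimit-order {h} {g} (δ , δ>0 , below) with <-dense δ>0
  ... | ε , ε>0 , ε<δ with trivial h | trivial g
  ... | false | false = strict (+-cancelʳ-< (- ε) (below ε ε>0 ε<δ))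
  ... | true  | false = strict (<-trans (below ε ε>0 ε<δ) (p-ε<p (U g) ε>0))
  ... | true  | true  = strict (below ε ε>0 ε<δ)
  ... | false | true  = ≤-fromSlack δ>0 (λ ε′ ε′>0 ε′<δ → p-ε<q⇒p<q+ε ε′ (below ε′ ε′>0 ε′<δ))
                      , λ { (inj₁ ()) ; (inj₂ ()) }

  upperLimit-≤ : ∀ {h g} → BelowInLimit upperε h g → U h ≤ U g
  upperLimit-≤ = proj₁ ∘ upperLimit-order

  upperLimit-< : ∀ {h g} → BelowInLimit upperε h g → trivial g ≡ false ⊎ trivial h ≡ true → U h < U g
  upperLimit-< = proj₂ ∘ upperLimit-order

module WitnessSets (G : Instance) where
  open Instance G
  open Multigraphs src tgt
  open SpanningTreeExchange src tgt
  open LimitTrees G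
  open RationalFacts
  open import Data.Rational using (ℚ; _≤_; _<_)
  open import Data.Rational.Properties using (≤-reflexive; <⇒≤; <-trans; ≤-<-trans; <-≤-trans; <-irrefl; <-dense)
  import Data.Nat.Properties as ℕ
  open import Data.Vec.Functional using (updateAt)
  open import Data.Vec.Functional.Properties using (updateAt-updates; updateAt-minimal)
  open import Data.Empty using (⊥; ⊥-elim)

  inI-open : ∀ {e x} → trivial e ≡ false → InI e x → L e < x × x < U e
  inI-open e-open (inj₁ (e-trivial , _))   = contradiction e-open (not-¬ e-trivial)
  inI-open e-open (inj₂ (_ , L<x , x<U)) = L<x , x<U

  inI-trivial : ∀ {e x} → trivial e ≡ true → InI e x → x ≡ U e
  inI-trivial {e} e-trivial (inj₁ (_ , x≡L))  = trans x≡L (trivial-LU e e-trivial)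
  inI-trivial     e-trivial (inj₂ (e-open , _)) = contradiction e-open (not-¬ e-trivial)

  w≤U : ∀ e → w e ≤ U e
  w≤U e with w-in e
  ... | inj₁ (e-trivial , _) = ≤-reflexive (inI-trivial e-trivial (w-in e))
  ... | inj₂ (_ , _ , w<U)   = <⇒≤ w<U

  module FirstCycleEdge (T : EdgeSet) (T-lower : IsUniqueLowerLimitTree T) (T-upper : IsUniqueUpperLimitTree T)
                        (l : ℕ) (f : Fin l → Fin m) (f-enum : IsOrderedNonTreeEnum T l f)
                        (i : Fin l) (lᵢ : Fin m) (lᵢ∈Cᵢ : InCycleOf T (f i) lᵢ) (lᵢ≢fᵢ : lᵢ ≢ f i)
                        (intervals-meet : ∃[ x ] (InI lᵢ x × InI (f i) x))
                        (lᵢ∉earlier : ∀ j → j F.< i → ¬ InCycleOf T (f j) lᵢ) where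

    fᵢ : Fin m
    fᵢ = f i

    Cᵢ : Cycle (addEdge T fᵢ)
    Cᵢ = proj₁ lᵢ∈Cᵢ

    T-tree : IsSpanningTree T
    T-tree = limitTree-isSpanningTree T-lower

    fᵢ∉T : T fᵢ ≡ false
    fᵢ∉T = proj₁ (proj₂ (proj₂ f-enum)) i

    lᵢ∈T : T lᵢ ≡ true
    lᵢ∈T = ∈-addEdge⁻ T lᵢ≢fᵢ (edgesOf-⊆ (Cycle.walk Cᵢ) (proj₂ lᵢ∈Cᵢ))

    lᵢ-lowerBelow : BelowInLimit lowerε lᵢ fᵢ
    lᵢ-lowerBelow = limitTree-cycle-below lowerε T-lower fᵢ∉T Cᵢ (proj₂ lᵢ∈Cᵢ) lᵢ≢fᵢ

    upperBelow : ∀ {h} → OnCycle h Cᵢ → h ≢ fᵢ → BelowInLimit upperε h fᵢ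
    upperBelow = limitTree-cycle-below upperε T-upper fᵢ∉T Cᵢ

    x : ℚ
    x = proj₁ intervals-meet

    x∈Iₗ : InI lᵢ x
    x∈Iₗ = proj₁ (proj₂ intervals-meet)

    x∈Iᶠ : InI fᵢ x
    x∈Iᶠ = proj₂ (proj₂ intervals-meet)

    fᵢ-open : trivial fᵢ ≡ false
    fᵢ-open = ¬-not fᵢ-not-trivial
      where
      lᵢ-upperBelow : BelowInLimit upperε lᵢ fᵢ
      lᵢ-upperBelow = upperBelow (proj₂ lᵢ∈Cᵢ) lᵢ≢fᵢ
      fᵢ-not-trivial : trivial fᵢ ≢ true
      fᵢ-not-trivial fᵢ-trivial with x∈Iₗ
      ... | inj₁ (lᵢ-trivial , _) = <-irrefl (trans (sym (inI-trivial lᵢ-trivial x∈Iₗ)) (inI-trivial fᵢ-trivial x∈Iᶠ))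
                                             (upperLimit-< lᵢ-upperBelow (inj₂ lᵢ-trivial))
      ... | inj₂ (_ , _ , x<U)     = <-irrefl (inI-trivial fᵢ-trivial x∈Iᶠ) (<-≤-trans x<U (upperLimit-≤ lᵢ-upperBelow))

    lᵢ-open : trivial lᵢ ≡ false
    lᵢ-open = ¬-not lᵢ-not-trivial
      where
      lᵢ-not-trivial : trivial lᵢ ≢ true
      lᵢ-not-trivial lᵢ-trivial with x∈Iₗ
      ... | inj₂ (lᵢ-open′ , _) = not-¬ lᵢ-trivial lᵢ-open′
      ... | inj₁ (_ , x≡L)      = <-irrefl refl (<-≤-trans (subst (L fᵢ <_) x≡L (proj₁ (inI-open fᵢ-open x∈Iᶠ)))
                                                           (lowerLimit-≤ lᵢ-lowerBelow))

    Llᵢ<Lfᵢ : L lᵢ < L fᵢ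
    Llᵢ<Lfᵢ = lowerLimit-< lᵢ-lowerBelow (inj₁ lᵢ-open)

    Ulᵢ<Ufᵢ : U lᵢ < U fᵢ
    Ulᵢ<Ufᵢ = upperLimit-< (upperBelow (proj₂ lᵢ∈Cᵢ) lᵢ≢fᵢ) (inj₁ fᵢ-open)

    Lfᵢ<Ulᵢ : L fᵢ < U lᵢ
    Lfᵢ<Ulᵢ = <-trans (proj₁ (inI-open fᵢ-open x∈Iᶠ)) (proj₂ (inI-open lᵢ-open x∈Iₗ))

    Lfᵢ<Ufᵢ : L fᵢ < U fᵢ
    Lfᵢ<Ufᵢ = open-LU fᵢ fᵢ-open

    w<Ufᵢ-onCᵢ : ∀ {h} → OnCycle h Cᵢ → h ≢ fᵢ → w h < U fᵢ
    w<Ufᵢ-onCᵢ h∈Cᵢ h≢fᵢ = ≤-<-trans (w≤U _) (upperLimit-< (upperBelow h∈Cᵢ h≢fᵢ) (inj₁ fᵢ-open))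

    Lfᵢ≤L-cycleThroughLᵢ : ∀ {g} → T g ≡ false → InCycleOf T g lᵢ → L fᵢ ≤ L g
    Lfᵢ≤L-cycleThroughLᵢ {g} g∉T lᵢ∈C with proj₁ (proj₂ f-enum) g g∉T
    ... | j , refl = proj₂ (proj₂ (proj₂ f-enum)) i j (ℕ.≮⇒≥ (λ j<i → lᵢ∉earlier j j<i lᵢ∈C))

    Lfᵢ<w-cycleThroughLᵢ : ∀ {g} → T g ≡ false → InCycleOf T g lᵢ → L fᵢ < w g
    Lfᵢ<w-cycleThroughLᵢ {g} g∉T lᵢ∈C with w-in g
    ... | inj₂ (_ , L<w , _)     = ≤-<-trans (Lfᵢ≤L-cycleThroughLᵢ g∉T lᵢ∈C) L<w
    ... | inj₁ (g-trivial , _)   = <-≤-trans Lfᵢ<Ulᵢ (subst (U lᵢ ≤_) (sym (inI-trivial g-trivial (w-in g))) Ulᵢ≤Ug)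
      where
      lᵢ≢g : lᵢ ≢ g
      lᵢ≢g refl = not-¬ lᵢ∈T g∉T
      Ulᵢ≤Ug : U lᵢ ≤ U g
      Ulᵢ≤Ug = upperLimit-≤ (limitTree-cycle-below upperε T-upper g∉T (proj₁ lᵢ∈C) (proj₂ lᵢ∈C) lᵢ≢g)

    module AvoidingQuery {Q : EdgeSet} (Q-feasible : Feasible Q) (fᵢ∉Q : Q fᵢ ≡ false)
                         (y : ℚ) (y∈Iₗ : InI lᵢ y) (y-agrees : Q lᵢ ≡ true → y ≡ w lᵢ) where

      T′ : EdgeSet
      T′ = proj₁ Q-feasible

      v : Fin m → ℚ
      v = updateAt w lᵢ (const y)

      w[_] : ℚ → Fin m → ℚ
      w[ z ] = updateAt v fᵢ (const z)

      v-lᵢ : v lᵢ ≡ y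
      v-lᵢ = updateAt-updates lᵢ w

      v-other : ∀ {h} → h ≢ lᵢ → v h ≡ w h
      v-other h≢lᵢ = updateAt-minimal _ lᵢ w h≢lᵢ

      w[z]-fᵢ : ∀ {z} → w[ z ] fᵢ ≡ z
      w[z]-fᵢ = updateAt-updates fᵢ v

      w[z]-other : ∀ {z h} → h ≢ fᵢ → w[ z ] h ≡ v h
      w[z]-other h≢fᵢ = updateAt-minimal _ fᵢ v h≢fᵢ

      v-agrees : ∀ h → Q h ≡ true → v h ≡ w h
      v-agrees h h∈Q with h F.≟ lᵢ
      ... | yes refl = trans v-lᵢ (y-agrees h∈Q)
      ... | no h≢lᵢ  = v-other h≢lᵢ

      v-inI : ∀ h → InI h (v h)
      v-inI h with h F.≟ lᵢ
      ... | yes refl = subst (InI lᵢ) (sym v-lᵢ) y∈Iₗ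
      ... | no h≢lᵢ  = subst (InI h) (sym (v-other h≢lᵢ)) (w-in h)

      w[z]-MST : ∀ {z} → L fᵢ < z → z < U fᵢ → IsMST w[ z ] T′
      w[z]-MST {z} L<z z<U = proj₂ Q-feasible w[ z ] agrees inI
        where
        agrees : ∀ h → Q h ≡ true → w[ z ] h ≡ w h
        agrees h h∈Q with h F.≟ fᵢ
        ... | yes refl = contradiction fᵢ∉Q (not-¬ h∈Q)
        ... | no h≢fᵢ  = trans (w[z]-other h≢fᵢ) (v-agrees h h∈Q)
        inI : ∀ h → Q h ≡ false → InI h (w[ z ] h)
        inI h _ with h F.≟ fᵢ
        ... | yes refl = subst (InI fᵢ) (sym w[z]-fᵢ) (inj₂ (fᵢ-open , L<z , z<U))
        ... | no h≢fᵢ  = subst (InI h) (sym (w[z]-other h≢fᵢ)) (v-inI h)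

      T′-tree : IsSpanningTree T′
      T′-tree = let z , L<z , z<U = <-dense Lfᵢ<Ufᵢ in proj₁ (w[z]-MST L<z z<U)

      fᵢ∈T′-impossible : T′ fᵢ ≡ true → y < U fᵢ → ⊥
      fᵢ∈T′-impossible fᵢ∈T′ y<U with cycle-crossesTwice (cutSide T′ fᵢ) Cᵢ (onCycle-added (proj₂ T-tree) Cᵢ)
                                                          (FundamentalCut.e-crosses T′-tree fᵢ∈T′)
      ... | h , h∈Cᵢ , h≢fᵢ , h-crosses = unbounded-above Lfᵢ<Ufᵢ vh<U z≤vh
        where
        h∉T′ : T′ h ≡ false
        h∉T′ = ¬-not (λ h∈T′ → h-crosses (FundamentalCut.sameSide-T T′-tree fᵢ∈T′ h∈T′ h≢fᵢ))
        z≤vh : ∀ z → L fᵢ < z → z < U fᵢ → z ≤ v h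
        z≤vh z L<z z<U =
          subst₂ _≤_ w[z]-fᵢ (w[z]-other h≢fᵢ) (exchange-≤ w[ z ] (w[z]-MST L<z z<U) fᵢ∈T′ h∉T′ h-crosses)
        vh<U : v h < U fᵢ
        vh<U with h F.≟ lᵢ
        ... | yes refl = subst (_< U fᵢ) (sym v-lᵢ) y<U
        ... | no h≢lᵢ  = subst (_< U fᵢ) (sym (v-other h≢lᵢ)) (w<Ufᵢ-onCᵢ h∈Cᵢ h≢fᵢ)

      fᵢ∉T′-impossible : T′ fᵢ ≡ false → L fᵢ < y → ⊥
      fᵢ∉T′-impossible fᵢ∉T′ L<y with toPath (proj₁ T′-tree (src fᵢ) (tgt fᵢ))
      ... | P , P-path
          with crossing-edge (cutSide T lᵢ) P (FundamentalCut.cycleEdge-crosses T-tree lᵢ∈T Cᵢ (proj₂ lᵢ∈Cᵢ))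
      ...   | g , g∈P , g-crosses = unbounded-below Lfᵢ<Ufᵢ L<vg vg≤z
        where
        g∈T′ : T′ g ≡ true
        g∈T′ = edgesOf-⊆ P g∈P
        g≢fᵢ : g ≢ fᵢ
        g≢fᵢ refl = not-¬ g∈T′ fᵢ∉T′
        fᵢ-crosses : Crosses (cutSide T′ g) fᵢ
        fᵢ-crosses = FundamentalCut.crossesOnce-treeWalk T′-tree g∈T′ P (path⇒edgesUnique P P-path) g∈P
        vg≤z : ∀ z → L fᵢ < z → z < U fᵢ → v g ≤ z
        vg≤z z L<z z<U =
          subst₂ _≤_ (w[z]-other g≢fᵢ) w[z]-fᵢ (exchange-≤ w[ z ] (w[z]-MST L<z z<U) g∈T′ fᵢ∉T′ fᵢ-crosses)
        L<vg : L fᵢ < v g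
        L<vg with g F.≟ lᵢ
        ... | yes refl = subst (L fᵢ <_) (sym v-lᵢ) L<y
        ... | no g≢lᵢ  = subst (L fᵢ <_) (sym (v-other g≢lᵢ))
                           (Lfᵢ<w-cycleThroughLᵢ g∉T (FundamentalCut.fundamentalCycle T-tree lᵢ∈T g∉T g-crosses))
          where
          g∉T : T g ≡ false
          g∉T = ¬-not (λ g∈T → g-crosses (FundamentalCut.sameSide-T T-tree lᵢ∈T g∈T g≢lᵢ))

      impossible : L fᵢ < y → y < U fᵢ → ⊥
      impossible L<y y<U with T′ fᵢ in fᵢ∈T′
      ... | true  = fᵢ∈T′-impossible fᵢ∈T′ y<U
      ... | false = fᵢ∉T′-impossible fᵢ∈T′ L<y

    witness-pair : IsWitnessSet (λ e → e ≡ lᵢ ⊎ e ≡ fᵢ)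
    witness-pair Q Q-feasible with Q lᵢ in lᵢ∈Q | Q fᵢ in fᵢ∈Q
    ... | true  | _     = lᵢ , inj₁ refl , lᵢ∈Q
    ... | false | true  = fᵢ , inj₂ refl , fᵢ∈Q
    ... | false | false with <-dense Lfᵢ<Ulᵢ
    ...   | y , L<y , y<U =
      ⊥-elim (AvoidingQuery.impossible Q-feasible fᵢ∈Q y y∈Iₗ y-agrees L<y (<-trans y<U Ulᵢ<Ufᵢ))
      where
      y∈Iₗ : InI lᵢ y
      y∈Iₗ = inj₂ (lᵢ-open , <-trans Llᵢ<Lfᵢ L<y , y<U)
      y-agrees : Q lᵢ ≡ true → y ≡ w lᵢ
      y-agrees lᵢ∈Q′ = contradiction lᵢ∈Q (not-¬ lᵢ∈Q′)

    witness-fᵢ : InI fᵢ (w lᵢ) → IsWitnessSet (λ e → e ≡ fᵢ)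
    witness-fᵢ wlᵢ∈Iᶠ Q Q-feasible with Q fᵢ in fᵢ∈Q
    ... | true  = fᵢ , refl , fᵢ∈Q
    ... | false = ⊥-elim (AvoidingQuery.impossible Q-feasible fᵢ∈Q (w lᵢ) (w-in lᵢ) (const refl) L<wlᵢ wlᵢ<U)
      where
      L<wlᵢ : L fᵢ < w lᵢ
      L<wlᵢ = proj₁ (inI-open fᵢ-open wlᵢ∈Iᶠ)
      wlᵢ<U : w lᵢ < U fᵢ
      wlᵢ<U = proj₂ (inI-open fᵢ-open wlᵢ∈Iᶠ)

-- Only now, since the modules above use the _<_ of ℚ.
open import Data.Fin using (_<_)

lemmaB3 : (G : Instance) → let open Instance G in
    (T : EdgeSet) → IsUniqueLowerLimitTree T → IsUniqueUpperLimitTree T →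
    (l : ℕ) (f : Fin l → Fin m) → IsOrderedNonTreeEnum T l f →
    (i : Fin l) (li : Fin m) →
    InCycleOf T (f i) li → li ≢ f i →
    (∃[ x ] (InI li x × InI (f i) x)) →
    (∀ j → j < i → ¬ InCycleOf T (f j) li) →
    IsWitnessSet (λ e → e ≡ li ⊎ e ≡ f i)
    × (InI (f i) (w li) → IsWitnessSet (λ e → e ≡ f i))
lemmaB3 G T T-lower T-upper l f f-enum i lᵢ lᵢ∈Cᵢ lᵢ≢fᵢ intervals-meet lᵢ∉earlier =
  witness-pair , witness-fᵢ
  where
  open WitnessSets.FirstCycleEdge G T T-lower T-upper l f f-enum i lᵢ lᵢ∈Cᵢ lᵢ≢fᵢ intervals-meet lᵢ∉earlier
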